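{- The equation $2^r - 1 = 3^s y^n$ has no solution in positive integers $r,s,y,n$ with $3\nmid y$, $y>1$ and $n>1$. -}

{-# OPTIONS --safe #-}
-- Since 3 divides 2^r − 1, r = 2k is even and 2^r − 1 = a (a + 2) with a = 2^k − 1 odd, so the two
-- factors are coprime. The one prime to 3 is then coprime to its cofactor in 3^s y^n, hence an n-th
-- power c^n with c > 1 odd, and c^n + 1 = 2^k or (with 3 ∤ c) c^n = 2^k + 1. For odd n, c^n ± 1 is
-- c ± 1 times an odd number larger than 1, which cannot divide a power of 2. For even n, c^n is an odd
-- square z², and z² + 1 ≡ 2 (mod 4) while z² ≡ 1 (mod 3) if 3 ∤ z, whereas 3 ∤ 2^k.
module Submission where

open import Data.Nat
  using (ℕ; zero; suc; _+_; _*_; _∸_; _^_; _<_; _≤_; z≤n; s≤s; NonZero; ≢-nonZero; ≢-nonZero⁻¹; >-nonZero)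
open import Data.Nat.Properties
open import Data.Nat.Divisibility
open import Data.Nat.DivMod using (_%_; _/_; m≡m%n+[m/n]*n; m%n<n; [m+kn]%n≡m%n; m*[n/m]≡n)
open import Data.Nat.GCD using (gcd; gcd[m,n]∣m; gcd[m,n]∣n; gcd[m,n]≢0)
open import Data.Nat.Coprimality as Coprime using (Coprime; coprime-divisor; coprime-+; coprime-/gcd)
open import Data.Nat.Primality using (Prime; prime?; prime[2]; euclidsLemma; prime⇒irreducible; ¬prime[1])
open import Data.Nat.Tactic.RingSolver using (solve-∀)
open import Data.Product using (∃-syntax; _×_; _,_)
open import Data.Sum using (inj₁; inj₂)
open import Relation.Binary.PropositionalEquality
  using (_≡_; _≢_; refl; sym; trans; cong; subst; module ≡-Reasoning)
open import Function using (_∘_)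
open import Relation.Nullary using (¬_; yes; no; contradiction)
open import Relation.Nullary.Decidable using (from-yes)

prime[3] : Prime 3
prime[3] = from-yes (prime? 3)

3∤2 : 3 ∤ 2
3∤2 = >⇒∤ (s≤s (s≤s (s≤s z≤n)))

prime∧∤⇒coprime : ∀ {p m} → Prime p → p ∤ m → Coprime m p
prime∧∤⇒coprime p-prime p∤m (d∣m , d∣p) with prime⇒irreducible p-prime d∣p
... | inj₁ d≡1 = d≡1
... | inj₂ refl = contradiction d∣m p∤m

prime∧∤⇒∤^ : ∀ {p m} k → Prime p → p ∤ m → p ∤ m ^ k
prime∧∤⇒∤^ zero p-prime _ p∣1 = ¬prime[1] (subst Prime (∣1⇒≡1 p∣1) p-prime)
prime∧∤⇒∤^ {m = m} (suc k) p-prime p∤m p∣m*m^k with euclidsLemma m (m ^ k) p-prime p∣m*m^k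
... | inj₁ p∣m = p∤m p∣m
... | inj₂ p∣m^k = prime∧∤⇒∤^ k p-prime p∤m p∣m^k

prime∧∤∧∣^⇒≡1 : ∀ {p m} k → Prime p → p ∤ m → m ∣ p ^ k → m ≡ 1
prime∧∤∧∣^⇒≡1 zero _ _ m∣1 = ∣1⇒≡1 m∣1
prime∧∤∧∣^⇒≡1 (suc k) p-prime p∤m m∣p*p^k =
  prime∧∤∧∣^⇒≡1 k p-prime p∤m (coprime-divisor (prime∧∤⇒coprime p-prime p∤m) m∣p*p^k)

coprime-*ˡ : ∀ {m n o} → Coprime m o → Coprime n o → Coprime (m * n) o
coprime-*ˡ {m} m⊥o n⊥o {d} (d∣mn , d∣o) = n⊥o (coprime-divisor d⊥m d∣mn , d∣o)
  where
  d⊥m : Coprime d m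
  d⊥m (e∣d , e∣m) = m⊥o (e∣m , ∣-trans e∣d d∣o)

coprime-^ˡ : ∀ {m n} k → Coprime m n → Coprime (m ^ k) n
coprime-^ˡ zero _ (d∣1 , _) = ∣1⇒≡1 d∣1
coprime-^ˡ (suc k) m⊥n = coprime-*ˡ m⊥n (coprime-^ˡ k m⊥n)

coprime-∣ˡ : ∀ {d m n} → d ∣ m → Coprime m n → Coprime d n
coprime-∣ˡ d∣m m⊥n (e∣d , e∣n) = m⊥n (∣-trans e∣d d∣m , e∣n)

^-distribʳ-* : ∀ m n o → (m * n) ^ o ≡ m ^ o * n ^ o
^-distribʳ-* m n zero = refl
^-distribʳ-* m n (suc o) =
  trans (cong (m * n *_) (^-distribʳ-* m n o)) ([m*n]*[o*p]≡[m*o]*[n*p] m n (m ^ o) (n ^ o))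

coprime∧*≡^⇒≡gcd^ : ∀ {a b y} n .{{_ : NonZero n}} .{{_ : NonZero a}} →
                    Coprime a b → a * b ≡ y ^ n → a ≡ gcd a y ^ n
coprime∧*≡^⇒≡gcd^ {a} {b} {y} (suc n) a⊥b ab≡y^n = begin
  a          ≡⟨ a≡g*a′ ⟩
  g * a′     ≡⟨ cong (g *_) (∣-antisym a′∣g^n g^n∣a′) ⟩
  g * g ^ n  ∎
  where
  open ≡-Reasoning
  g : ℕ
  g = gcd a y
  instance
    g≢0 : NonZero g
    g≢0 = ≢-nonZero (gcd[m,n]≢0 a y (inj₁ (≢-nonZero⁻¹ a)))
  a′ : ℕ
  a′ = a / g
  y′ : ℕ
  y′ = y / g
  a≡g*a′ : a ≡ g * a′
  a≡g*a′ = sym (m*[n/m]≡n (gcd[m,n]∣m a y))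
  a′b≡g^n*y′^n : a′ * b ≡ g ^ n * y′ ^ suc n
  a′b≡g^n*y′^n = *-cancelˡ-≡ _ _ g (begin
    g * (a′ * b)                 ≡⟨ *-assoc g a′ b ⟨
    g * a′ * b                   ≡⟨ cong (_* b) a≡g*a′ ⟨
    a * b                        ≡⟨ ab≡y^n ⟩
    y ^ suc n                    ≡⟨ cong (_^ suc n) (m*[n/m]≡n (gcd[m,n]∣n a y)) ⟨
    (g * y′) ^ suc n             ≡⟨ ^-distribʳ-* g y′ (suc n) ⟩
    g * g ^ n * y′ ^ suc n       ≡⟨ *-assoc g (g ^ n) (y′ ^ suc n) ⟩
    g * (g ^ n * y′ ^ suc n)     ∎)
  a′∣g^n : a′ ∣ g ^ n
  a′∣g^n = coprime-divisor (Coprime.sym (coprime-^ˡ (suc n) (Coprime.sym (coprime-/gcd a y))))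
             (divides b
               (trans (*-comm (y′ ^ suc n) (g ^ n)) (trans (sym a′b≡g^n*y′^n) (*-comm a′ b))))
  g^n∣a′ : g ^ n ∣ a′
  g^n∣a′ = coprime-divisor (coprime-^ˡ n (coprime-∣ˡ (gcd[m,n]∣m a y) a⊥b))
             (divides (y′ ^ suc n)
               (trans (*-comm b a′) (trans a′b≡g^n*y′^n (*-comm (g ^ n) (y′ ^ suc n)))))

coprime∧*≡*^⇒≡gcd^ : ∀ {a b m y} n .{{_ : NonZero n}} .{{_ : NonZero a}} .{{_ : NonZero m}} →
                     Coprime a b → Coprime m a → a * b ≡ m * y ^ n → a ≡ gcd a y ^ n
coprime∧*≡*^⇒≡gcd^ {a} {b} {m} {y} n a⊥b m⊥a ab≡my^n = coprime∧*≡^⇒≡gcd^ n a⊥q aq≡y^n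
  where
  m∣b : m ∣ b
  m∣b = coprime-divisor m⊥a (divides (y ^ n) (trans ab≡my^n (*-comm m (y ^ n))))
  q : ℕ
  q = quotient m∣b
  a⊥q : Coprime a q
  a⊥q = Coprime.sym (coprime-∣ˡ (quotient-∣ m∣b) (Coprime.sym a⊥b))
  swap : ∀ m a q → m * (a * q) ≡ a * (m * q)
  swap = solve-∀
  aq≡y^n : a * q ≡ y ^ n
  aq≡y^n = *-cancelˡ-≡ _ _ m
    (trans (swap m a q) (trans (cong (a *_) (sym (m∣n⇒n≡m*quotient m∣b))) ab≡my^n))

m^[n*2]≡m^n*m^n : ∀ m n → m ^ (n * 2) ≡ m ^ n * m ^ n
m^[n*2]≡m^n*m^n m n = trans (cong (m ^_) (n*2≡n+n n)) (^-distribˡ-+-* m n n)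
  where
  n*2≡n+n : ∀ n → n * 2 ≡ n + n
  n*2≡n+n = solve-∀

1<m^n⇒1<m : ∀ {m} n → 1 < m ^ n → 1 < m
1<m^n⇒1<m {0} zero (s≤s ())
1<m^n⇒1<m {1} n 1<1^n = contradiction (subst (1 <_) (^-zeroˡ n) 1<1^n) (<-irrefl refl)
1<m^n⇒1<m {suc (suc m)} _ _ = s≤s (s≤s z≤n)

m∣m^n : ∀ m {n} .{{_ : NonZero n}} → m ∣ m ^ n
m∣m^n m {suc n} = m∣m*n (m ^ n)

2∤1+k*2 : ∀ k → 2 ∤ 1 + k * 2
2∤1+k*2 k 2∣1+k*2 with trans (sym ([m+kn]%n≡m%n 1 k 2)) (n∣m⇒m%n≡0 _ 2 2∣1+k*2)
... | ()

2∤⇒≡1+k*2 : ∀ {n} → 2 ∤ n → ∃[ k ] n ≡ 1 + k * 2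
2∤⇒≡1+k*2 {n} 2∤n with n % 2 | m≡m%n+[m/n]*n n 2 | m%n<n n 2
... | 0 | n≡0+k*2 | _ = contradiction (divides (n / 2) n≡0+k*2) 2∤n
... | 1 | n≡1+k*2 | _ = n / 2 , n≡1+k*2
... | suc (suc _) | _ | s≤s (s≤s ())

geometricSum : ℕ → ℕ → ℕ
geometricSum x zero = 0
geometricSum x (suc m) = 1 + x * geometricSum x m

geometricSum-closed : ∀ d m → d * geometricSum (1 + d) m + 1 ≡ (1 + d) ^ m
geometricSum-closed d zero = cong (_+ 1) (*-zeroʳ d)
geometricSum-closed d (suc m) = begin
  d * (1 + (1 + d) * S) + 1  ≡⟨ step d S ⟩
  (1 + d) * (d * S + 1)      ≡⟨ cong ((1 + d) *_) (geometricSum-closed d m) ⟩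
  (1 + d) * (1 + d) ^ m      ∎
  where
  open ≡-Reasoning
  S : ℕ
  S = geometricSum (1 + d) m
  step : ∀ d S → d * (1 + (1 + d) * S) + 1 ≡ (1 + d) * (d * S + 1)
  step = solve-∀

m≤geometricSum : ∀ x m → m ≤ geometricSum (1 + x) m
m≤geometricSum x zero = z≤n
m≤geometricSum x (suc m) =
  s≤s (≤-trans (m≤geometricSum x m) (m≤m+n _ (x * geometricSum (1 + x) m)))

2∣geometricSum[odd]+m : ∀ d m → 2 ∣ geometricSum (1 + d * 2) m + m
2∣geometricSum[odd]+m d zero = divides 0 refl
2∣geometricSum[odd]+m d (suc m) =
  subst (2 ∣_) (sym (step d S m)) (∣m∣n⇒∣m+n (2∣geometricSum[odd]+m d m) (n∣m*n (1 + d * S)))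
  where
  S : ℕ
  S = geometricSum (1 + d * 2) m
  step : ∀ d S m → 1 + (1 + d * 2) * S + suc m ≡ (S + m) + (1 + d * S) * 2
  step = solve-∀

2∤geometricSum[odd] : ∀ d {m} → 2 ∤ m → 2 ∤ geometricSum (1 + d * 2) m
2∤geometricSum[odd] d {m} 2∤m 2∣S = 2∤m (∣m+n∣m⇒∣n (2∣geometricSum[odd]+m d m) 2∣S)

*[odd>1]≢2^ : ∀ m {u} k → 2 ∤ u → 1 < u → m * u ≢ 2 ^ k
*[odd>1]≢2^ m k 2∤u 1<u mu≡2^k =
  <⇒≢ 1<u (sym (prime∧∤∧∣^⇒≡1 k prime[2] 2∤u (divides m (sym mu≡2^k))))

odd^odd≢2^+1 : ∀ {c n} k → 2 ∤ c → 2 ∤ n → 1 < n → c ^ n ≢ 2 ^ k + 1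
odd^odd≢2^+1 {n = n} k 2∤c 2∤n 1<n c^n≡2^k+1 with 2∤⇒≡1+k*2 2∤c
... | d , refl = *[odd>1]≢2^ (d * 2) k (2∤geometricSum[odd] d 2∤n)
                   (≤-trans 1<n (m≤geometricSum (d * 2) n))
                   (+-cancelʳ-≡ 1 _ _ (trans (geometricSum-closed (d * 2) n) c^n≡2^k+1))

-- c² − 1 = 4e(1 + e) is a multiple of 2(c + 1), which makes the cofactor of c + 1 odd.
odd^odd+1-factorisation : ∀ e u → let c = 1 + e * 2 in
  c ^ (1 + u * 2) + 1 ≡ (1 + e) * 2 * (1 + c * e * geometricSum (1 + e * (1 + e) * 4) u * 2)
odd^odd+1-factorisation e u = begin
  c * c ^ (u * 2) + 1                   ≡⟨ cong (λ x → c * c ^ x + 1) (*-comm u 2) ⟩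
  c * c ^ (2 * u) + 1                   ≡⟨ cong (λ x → c * x + 1) (^-*-assoc c 2 u) ⟨
  c * (c ^ 2) ^ u + 1                   ≡⟨ cong (λ x → c * x ^ u + 1) (c²≡1+D e) ⟩
  c * (1 + D) ^ u + 1                   ≡⟨ cong (λ x → c * x + 1) (geometricSum-closed D u) ⟨
  c * (D * S + 1) + 1                   ≡⟨ factorise e S ⟩
  (1 + e) * 2 * (1 + c * e * S * 2)     ∎
  where
  open ≡-Reasoning
  c : ℕ
  c = 1 + e * 2
  D : ℕ
  D = e * (1 + e) * 4
  S : ℕ
  S = geometricSum (1 + D) u
  c²≡1+D : ∀ e → (1 + e * 2) * ((1 + e * 2) * 1) ≡ 1 + e * (1 + e) * 4
  c²≡1+D = solve-∀
  factorise : ∀ e S → (1 + e * 2) * (e * (1 + e) * 4 * S + 1) + 1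
                      ≡ (1 + e) * 2 * (1 + (1 + e * 2) * e * S * 2)
  factorise = solve-∀

odd^odd+1≢2^ : ∀ {c n} k → 2 ∤ c → 2 ∤ n → 1 < c → 1 < n → c ^ n + 1 ≢ 2 ^ k
odd^odd+1≢2^ k 2∤c 2∤n 1<c 1<n with 2∤⇒≡1+k*2 2∤c | 2∤⇒≡1+k*2 2∤n
... | zero , refl | _ = contradiction 1<c (<-irrefl refl)
... | _ | zero , refl = contradiction 1<n (<-irrefl refl)
... | suc e , refl | suc u , refl =
  λ c^n+1≡2^k → *[odd>1]≢2^ ((2 + e) * 2) k (2∤1+k*2 t) (s≤s (s≤s z≤n))
                  (trans (sym (odd^odd+1-factorisation (suc e) (suc u))) c^n+1≡2^k)
  where
  t : ℕ
  t = (1 + suc e * 2) * suc e * geometricSum (1 + suc e * (2 + e) * 4) (suc u)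

odd²+1≢2^ : ∀ {z} k → 2 ∤ z → 1 < z → z * z + 1 ≢ 2 ^ k
odd²+1≢2^ k 2∤z 1<z with 2∤⇒≡1+k*2 2∤z
... | zero , refl = contradiction 1<z (<-irrefl refl)
... | suc f , refl = λ z²+1≡2^k →
  *[odd>1]≢2^ 2 k (2∤1+k*2 (suc f * (2 + f))) (s≤s (s≤s z≤n))
    (trans (sym (factorise (suc f))) z²+1≡2^k)
  where
  factorise : ∀ f → (1 + f * 2) * (1 + f * 2) + 1 ≡ 2 * (1 + f * (1 + f) * 2)
  factorise = solve-∀

3∤⇒square≡*3+1 : ∀ {z} → 3 ∤ z → ∃[ t ] z * z ≡ t * 3 + 1
3∤⇒square≡*3+1 {z} 3∤z with z % 3 | z / 3 | m≡m%n+[m/n]*n z 3 | m%n<n z 3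
... | 0 | q | z≡q*3 | _ = contradiction (divides q z≡q*3) 3∤z
... | 1 | q | refl | _ = q * (q * 3 + 2) , square₁ q
  where
  square₁ : ∀ q → (1 + q * 3) * (1 + q * 3) ≡ q * (q * 3 + 2) * 3 + 1
  square₁ = solve-∀
... | 2 | q | refl | _ = 1 + q * (q * 3 + 4) , square₂ q
  where
  square₂ : ∀ q → (2 + q * 3) * (2 + q * 3) ≡ (1 + q * (q * 3 + 4)) * 3 + 1
  square₂ = solve-∀
... | suc (suc (suc _)) | _ | _ | s≤s (s≤s (s≤s ()))

square≢2^+1 : ∀ {z} k → 3 ∤ z → z * z ≢ 2 ^ k + 1
square≢2^+1 k 3∤z z²≡2^k+1 with 3∤⇒square≡*3+1 3∤z
... | t , z²≡t*3+1 = prime∧∤⇒∤^ k prime[3] 3∤2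
                       (divides t (+-cancelʳ-≡ 1 _ _ (trans (sym z²≡2^k+1) z²≡t*3+1)))

odd^+1≢2^ : ∀ {c} n k → 2 ∤ c → 1 < c → 1 < n → c ^ n + 1 ≢ 2 ^ k
odd^+1≢2^ {c} n k 2∤c 1<c 1<n with 2 ∣? n
... | no 2∤n = odd^odd+1≢2^ k 2∤c 2∤n 1<c 1<n
... | yes (divides (suc u) refl) =
  odd²+1≢2^ k (prime∧∤⇒∤^ (suc u) prime[2] 2∤c) (^-monoʳ-< c 1<c (s≤s (z≤n {u})))
  ∘ trans (cong (_+ 1) (sym (m^[n*2]≡m^n*m^n c (suc u))))

odd^≢2^+1 : ∀ {c} n k → 2 ∤ c → 3 ∤ c → 1 < n → c ^ n ≢ 2 ^ k + 1
odd^≢2^+1 {c} n k 2∤c 3∤c 1<n with 2 ∣? n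
... | no 2∤n = odd^odd≢2^+1 k 2∤c 2∤n 1<n
... | yes (divides u refl) =
  square≢2^+1 k (prime∧∤⇒∤^ u prime[3] 3∤c) ∘ trans (sym (m^[n*2]≡m^n*m^n c u))

3∣2^odd+1 : ∀ k → 3 ∣ 2 ^ (1 + k * 2) + 1
3∣2^odd+1 zero = divides 1 refl
3∣2^odd+1 (suc k) =
  ∣m+n∣m⇒∣n (subst (3 ∣_) (step (2 ^ (1 + k * 2))) (∣n⇒∣m*n 4 (3∣2^odd+1 k))) ∣-refl
  where
  step : ∀ x → 4 * (x + 1) ≡ 3 + (2 * (2 * x) + 1)
  step = solve-∀

3∣∧2^≡1+⇒2∣ : ∀ {r N} → 3 ∣ N → 2 ^ r ≡ 1 + N → 2 ∣ r
3∣∧2^≡1+⇒2∣ {r} {N} 3∣N 2^r≡1+N with 2 ∣? r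
... | yes 2∣r = 2∣r
... | no 2∤r with 2∤⇒≡1+k*2 2∤r
...   | k , refl = contradiction (∣m+n∣m⇒∣n (subst (3 ∣_) 2^r+1≡N+2 (3∣2^odd+1 k)) 3∣N) 3∤2
  where
  2^r+1≡N+2 : 2 ^ (1 + k * 2) + 1 ≡ N + 2
  2^r+1≡N+2 = trans (cong (_+ 1) 2^r≡1+N) (sym (+-suc N 1))

2∤2^∸1 : ∀ k → 0 < 2 ^ k ∸ 1 → 2 ∤ 2 ^ k ∸ 1
2∤2^∸1 (suc k) _ 2∣2^k∸1 =
  >⇒∤ (s≤s (s≤s z≤n)) (∣m+n∣m⇒∣n 2∣2^k∸1+1 2∣2^k∸1)
  where
  2∣2^k∸1+1 : 2 ∣ 2 ^ suc k ∸ 1 + 1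
  2∣2^k∸1+1 = subst (2 ∣_) (sym (m∸n+n≡m (m^n>0 2 (suc k)))) (m∣m*n (2 ^ k))

square≡1+⇒≡[∸1]*[∸1+2] : ∀ {b N} .{{_ : NonZero b}} →
                          b * b ≡ 1 + N → N ≡ (b ∸ 1) * (b ∸ 1 + 2)
square≡1+⇒≡[∸1]*[∸1+2] {suc a} b²≡1+N = suc-injective (trans (sym b²≡1+N) (expand a))
  where
  expand : ∀ a → suc a * suc a ≡ 1 + a * (a + 2)
  expand = solve-∀

factor-of-3^*^-is-power : ∀ {a b} s y n .{{_ : NonZero n}} →
                          Coprime a b → 2 ∤ a → 3 ∤ a → 1 < a → a * b ≡ 3 ^ s * y ^ n →
                          ∃[ c ] a ≡ c ^ n × 1 < c × 2 ∤ c × 3 ∤ c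
factor-of-3^*^-is-power {a} s y n a⊥b 2∤a 3∤a 1<a ab≡3^s*y^n =
  gcd a y , a≡c^n , 1<m^n⇒1<m n (subst (1 <_) a≡c^n 1<a) , ∤-gcd 2∤a , ∤-gcd 3∤a
  where
  instance
    a≢0 : NonZero a
    a≢0 = >-nonZero (<⇒≤ 1<a)
    3^s≢0 : NonZero (3 ^ s)
    3^s≢0 = m^n≢0 3 s
  a≡c^n : a ≡ gcd a y ^ n
  a≡c^n = coprime∧*≡*^⇒≡gcd^ n a⊥b
            (coprime-^ˡ s (Coprime.sym (prime∧∤⇒coprime prime[3] 3∤a))) ab≡3^s*y^n
  ∤-gcd : ∀ {p} → p ∤ a → p ∤ gcd a y
  ∤-gcd p∤a p∣c = p∤a (∣-trans p∣c (gcd[m,n]∣m a y))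

odd⇒coprime[+2] : ∀ {a} → 2 ∤ a → Coprime a (a + 2)
odd⇒coprime[+2] 2∤a = Coprime.sym (coprime-+ (Coprime.sym (prime∧∤⇒coprime prime[2] 2∤a)))

∣∧∤⇒∤+ : ∀ {d m n} → d ∣ m → d ∤ n → d ∤ m + n
∣∧∤⇒∤+ d∣m d∤n d∣m+n = d∤n (∣m+n∣m⇒∣n d∣m+n d∣m)

a*[a+2]≢3^*^ : ∀ {a} k s y n → 2 ^ k ≡ 1 + a → 2 ∤ a → 1 < a → 1 < n →
               a * (a + 2) ≢ 3 ^ s * y ^ n
a*[a+2]≢3^*^ {a} k s y n@(suc _) 2^k≡1+a 2∤a 1<a 1<n a[a+2]≡3^s*y^n with 3 ∣? a
... | no 3∤a =
  -- `let`, not `with`: with-abstracting over this term makes type checking blow up.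
  let c , a≡c^n , 1<c , 2∤c , _ =
        factor-of-3^*^-is-power s y n (odd⇒coprime[+2] 2∤a) 2∤a 3∤a 1<a a[a+2]≡3^s*y^n
  in odd^+1≢2^ n k 2∤c 1<c 1<n (trans (cong (_+ 1) (sym a≡c^n)) (trans (+-comm a 1) (sym 2^k≡1+a)))
... | yes 3∣a =
  let c , a+2≡c^n , _ , 2∤c , 3∤c =
        factor-of-3^*^-is-power s y n (Coprime.sym (odd⇒coprime[+2] 2∤a))
          (subst (2 ∤_) (+-comm 2 a) (∣∧∤⇒∤+ ∣-refl 2∤a)) (∣∧∤⇒∤+ 3∣a 3∤2)
          (m≤n+m 2 a) (trans (*-comm (a + 2) a) a[a+2]≡3^s*y^n)
  in odd^≢2^+1 n k 2∤c 3∤c 1<n (trans (sym a+2≡c^n) (trans (+-suc a 1) (cong (_+ 1) (sym 2^k≡1+a))))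

3<a*[a+2]⇒1<a : ∀ {a} → 3 < a * (a + 2) → 1 < a
3<a*[a+2]⇒1<a {0} ()
3<a*[a+2]⇒1<a {1} (s≤s (s≤s (s≤s ())))
3<a*[a+2]⇒1<a {suc (suc a)} _ = s≤s (s≤s z≤n)

lemma2p10 : (r s y n : ℕ) → 1 ≤ r → 1 ≤ s → 1 < y → 1 < n → ¬ (3 ∣ y) →
    ¬ (2 ^ r ∸ 1 ≡ 3 ^ s * y ^ n)
lemma2p10 r s y n _ 1≤s 1<y 1<n _ 2^r∸1≡N =
  a*[a+2]≢3^*^ k s y n 2^k≡1+a (2∤2^∸1 k (<⇒≤ 1<a)) 1<a 1<n (sym N≡a*[a+2])
  where
  N : ℕ
  N = 3 ^ s * y ^ n
  2^r≡1+N : 2 ^ r ≡ 1 + N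
  2^r≡1+N = trans (sym (m∸n+n≡m (m^n>0 2 r))) (trans (cong (_+ 1) 2^r∸1≡N) (+-comm N 1))
  2∣r : 2 ∣ r
  2∣r = 3∣∧2^≡1+⇒2∣ (∣m⇒∣m*n (y ^ n) (m∣m^n 3 {{>-nonZero 1≤s}})) 2^r≡1+N
  k : ℕ
  k = quotient 2∣r
  a : ℕ
  a = 2 ^ k ∸ 1
  2^k≡1+a : 2 ^ k ≡ 1 + a
  2^k≡1+a = sym (m+[n∸m]≡n (m^n>0 2 k))
  N≡a*[a+2] : N ≡ a * (a + 2)
  N≡a*[a+2] = square≡1+⇒≡[∸1]*[∸1+2] {{m^n≢0 2 k}}
    (trans (sym (m^[n*2]≡m^n*m^n 2 k))
           (subst (λ r → 2 ^ r ≡ 1 + N) (m∣n⇒n≡quotient*m 2∣r) 2^r≡1+N))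
  3<N : 3 < N
  3<N = ≤-trans (m≤m+n 4 2) (*-mono-≤ (^-monoʳ-≤ 3 1≤s) (^-monoʳ-< y 1<y (<⇒≤ 1<n)))
  1<a : 1 < a
  1<a = 3<a*[a+2]⇒1<a (subst (3 <_) N≡a*[a+2] 3<N)
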